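{- Let $\mathcal{V}$ and $\mathcal{W}$ be quantaloids and $F:\mathcal{V}\to\mathcal{W}$ a two-sided enrichment such that every monotone map $F_{x,y}:\mathcal{V}(x_-,y_-)\to\mathcal{W}(x_+,y_+)$ has a right adjoint. Then the induced change of base $F_@:\mathcal{V}\text{ - }\mathbf{Cat}\to\mathcal{W}\text{ - }\mathbf{Cat}$ maps every $\mathcal{V}$-functor in $\mathbb{O}\mathrm{d}$ to a $\mathcal{W}$-functor in $\mathbb{O}\mathrm{d}$; consequently, if $\mathbb{A}$ and $\mathbb{B}$ are bisimilar $\mathcal{V}$-categories then $F_@\mathbb{A}$ and $F_@\mathbb{B}$ are bisimilar $\mathcal{W}$-categories.
   Context: A quantaloid $\mathcal{V}$ is a small, locally ordered bicategory whose hom-posets are complete lattices and which is biclosed (for every arrow $f$, $-\otimes f$ and $f\otimes -$ have right adjoints, $\otimes$ = horizontal composition in diagrammatic order). A $\mathcal{V}$-category $\mathbb{A}$: a set $\mathrm{Obj}(\mathbb{A})$, a map $a\mapsto a_+\in\mathrm{Obj}(\mathcal{V})$, arrows $\mathbb{A}(a,b):a_+\to b_+$ with $id_{a_+}\le\mathbb{A}(a,a)$, $\mathbb{A}(a,b)\otimes\mathbb{A}(b,c)\le\mathbb{A}(a,c)$. A $\mathcal{V}$-functor $f:\mathbb{A}\to\mathbb{B}$: a map on objects with $(fa)_+=a_+$ and $\mathbb{A}(a,a')\le\mathbb{B}(fa,fa')$. A two-sided enrichment $F:\mathcal{V}\to\mathcal{W}$ consists of a set $\mathrm{Obj}(F)$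 with maps $x\mapsto x_-\in\mathrm{Obj}(\mathcal{V})$, $x\mapsto x_+\in\mathrm{Obj}(\mathcal{W})$, and monotone maps $F_{x,y}:\mathcal{V}(x_-,y_-)\to\mathcal{W}(x_+,y_+)$ for $x,y\in\mathrm{Obj}(F)$ such that $F_{x,y}(u)\otimes F_{y,z}(v)\le F_{x,z}(u\otimes v)$ and $id_{x_+}\le F_{x,x}(id_{x_- })$. The change of base $F_@$ sends a $\mathcal{V}$-category $\mathbb{A}$ to the $\mathcal{W}$-category $F_@\mathbb{A}$ with objects the pairs $(a,x)\in\mathrm{Obj}(\mathbb{A})\times\mathrm{Obj}(F)$ with $a_+=x_-$, $(a,x)_+=x_+$, and $F_@\mathbb{A}((a,x),(b,y))=F_{x,y}(\mathbb{A}(a,b))$; it sends a $\mathcal{V}$-functor $f$ to the $\mathcal{W}$-functor $(a,x)\mapsto(fa,x)$. A functional bisimulation is a functor $f:\mathbb{A}\to\mathbb{B}$ (over the relevant quantaloid) with $\mathbb{B}(f(a),b)=\bigvee_{a':f(a')=b}\mathbb{A}(a,a')$ for all $a,b$; $\mathbb{O}\mathrm{d}$ is the class of functional bisimulations surjective on objects. A simulation from $\mathbb{A}$ to $\mathbb{B}$: a relation $R$ with $(a,b)\in R\Rightarrow a_+=b_+$ and $\mathbb{A}(a,a')\le\bigvee_{b':(a',b')\in R}\mathbb{B}(b,b')$ for all $(a,b)\in R$, $a'$; a bisimulation: $R$ and $R^{ -1}$ are simulations; $\mathbb{A},\mathbb{B}$ are bisimilar if some bisimulation relates every object of $\mathbb{A}$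 to some object of $\mathbb{B}$ and every object of $\mathbb{B}$ to some object of $\mathbb{A}$. -}

module Defs where

open import Data.Product using (Σ; _×_; _,_; proj₁; proj₂; ∃)
open import Function using (flip)
open import Function.Bundles using (_⇔_)
open import Relation.Binary.PropositionalEquality
  using (_≡_; refl; sym; trans; cong; subst)

-- Composition _⊗_ is written in diagrammatic order.
-- In a locally ordered bicategory the associativity/unit 2-cells are
-- isomorphisms in a poset, i.e. equalities.

record Quantaloid : Set₁ where
  infixr 7 _⊗_
  infix 4 _≤_
  field
    Ob  : Set
    Hom : Ob → Ob → Set
    _≤_ : ∀ {x y} → Hom x y → Hom x y → Set
    ≤-refl    : ∀ {x y} {u : Hom x y} → u ≤ u
    ≤-trans   : ∀ {x y} {u v w : Hom x y} → u ≤ v → v ≤ w → u ≤ w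
    ≤-antisym : ∀ {x y} {u v : Hom x y} → u ≤ v → v ≤ u → u ≡ v
    ⋁       : ∀ {x y} (I : Set) → (I → Hom x y) → Hom x y
    ⋁-ub    : ∀ {x y} {I : Set} (u : I → Hom x y) (i : I) → u i ≤ ⋁ I u
    ⋁-least : ∀ {x y} {I : Set} (u : I → Hom x y) (w : Hom x y) →
              (∀ i → u i ≤ w) → ⋁ I u ≤ w
    id      : ∀ {x} → Hom x x
    _⊗_     : ∀ {x y z} → Hom x y → Hom y z → Hom x z
    ⊗-assoc : ∀ {x y z w} (u : Hom x y) (v : Hom y z) (t : Hom z w) →
              (u ⊗ v) ⊗ t ≡ u ⊗ (v ⊗ t)
    ⊗-idˡ   : ∀ {x y} (u : Hom x y) → id ⊗ u ≡ u
    ⊗-idʳ   : ∀ {x y} (u : Hom x y) → u ⊗ id ≡ u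
    ⊗-mono  : ∀ {x y z} {u u' : Hom x y} {v v' : Hom y z} →
              u ≤ u' → v ≤ v' → u ⊗ v ≤ u' ⊗ v'
    _↙_   : ∀ {x y z} → Hom x z → Hom y z → Hom x y
    ↙-adj : ∀ {x y z} (g : Hom x y) (f : Hom y z) (h : Hom x z) →
            (g ⊗ f ≤ h) ⇔ (g ≤ h ↙ f)
    _↘_   : ∀ {x y z} → Hom x y → Hom x z → Hom y z
    ↘-adj : ∀ {x y z} (f : Hom x y) (g : Hom y z) (h : Hom x z) →
            (f ⊗ g ≤ h) ⇔ (g ≤ f ↘ h)

module QuantaloidLemmas (Q : Quantaloid) where
  open Quantaloid Q

  cast : ∀ {x x' y y'} → x ≡ x' → y ≡ y' → Hom x y → Hom x' y'
  cast refl refl u = u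

  cast-mono : ∀ {x x' y y'} (e : x ≡ x') (e' : y ≡ y') {u v : Hom x y} →
              u ≤ v → cast e e' u ≤ cast e e' v
  cast-mono refl refl p = p

  cast-id : ∀ {x x'} (e : x ≡ x') → cast e e id ≡ id
  cast-id refl = refl

  cast-⊗ : ∀ {x x' y y' z z'} (e₁ : x ≡ x') (e₂ : y ≡ y') (e₃ : z ≡ z')
           (u : Hom x y) (v : Hom y z) →
           cast e₁ e₂ u ⊗ cast e₂ e₃ v ≡ cast e₁ e₃ (u ⊗ v)
  cast-⊗ refl refl refl u v = refl

  cast-cast : ∀ {x x' x'' y y' y''} (e₁ : x ≡ x') (e₁' : y ≡ y')
              (e₂ : x' ≡ x'') (e₂' : y' ≡ y'') (u : Hom x y) →
              cast e₂ e₂' (cast e₁ e₁' u) ≡ cast (trans e₁ e₂) (trans e₁' e₂') u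
  cast-cast refl refl refl refl u = refl

  ≤-reflexive : ∀ {x y} {u v : Hom x y} → u ≡ v → u ≤ v
  ≤-reflexive refl = ≤-refl

record VCat (V : Quantaloid) : Set₁ where
  open Quantaloid V
  field
    Obj  : Set
    ty   : Obj → Ob
    hom  : (a b : Obj) → Hom (ty a) (ty b)
    hom-id   : ∀ a → id ≤ hom a a
    hom-comp : ∀ a b c → hom a b ⊗ hom b c ≤ hom a c

module _ {V : Quantaloid} where
  open Quantaloid V
  open QuantaloidLemmas V
  open VCat

  record VFunctor (A B : VCat V) : Set where
    field
      fun  : Obj A → Obj B
      pres : ∀ a → ty B (fun a) ≡ ty A a
      mono : ∀ a a' → hom A a a' ≤ cast (pres a) (pres a') (hom B (fun a) (fun a'))
  open VFunctor

  IsFunctionalBisimulation : {A B : VCat V} → VFunctor A B → Set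
  IsFunctionalBisimulation {A} {B} f =
    ∀ (a : Obj A) (b : Obj B) →
      hom B (fun f a) b ≡
      ⋁ (Σ (Obj A) λ a' → fun f a' ≡ b)
        (λ { (a' , e) → cast (sym (pres f a)) (trans (sym (pres f a')) (cong (ty B) e))
                             (hom A a a') })

  SurjectiveOnObjects : {A B : VCat V} → VFunctor A B → Set
  SurjectiveOnObjects {A} {B} f = ∀ (b : Obj B) → Σ (Obj A) λ a → fun f a ≡ b

  InOd : {A B : VCat V} → VFunctor A B → Set
  InOd f = IsFunctionalBisimulation f × SurjectiveOnObjects f

  IsSimulation : (A B : VCat V) → (Obj A → Obj B → Set) → Set
  IsSimulation A B R =
    Σ (∀ {a b} → R a b → ty A a ≡ ty B b) λ typ →
      ∀ a b (r : R a b) (a' : Obj A) →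
        hom A a a' ≤
        ⋁ (Σ (Obj B) λ b' → R a' b')
          (λ { (b' , r') → cast (sym (typ r)) (sym (typ r')) (hom B b b') })

  IsBisimulation : (A B : VCat V) → (Obj A → Obj B → Set) → Set
  IsBisimulation A B R = IsSimulation A B R × IsSimulation B A (flip R)

  Bisimilar : (A B : VCat V) → Set₁
  Bisimilar A B =
    Σ (Obj A → Obj B → Set) λ R →
      IsBisimulation A B R
      × (∀ a → Σ (Obj B) λ b → R a b)
      × (∀ b → Σ (Obj A) λ a → R a b)

record TwoSidedEnrichment (V W : Quantaloid) : Set₁ where
  private
    module V = Quantaloid V
    module W = Quantaloid W
  field
    Obj   : Set
    minus : Obj → V.Ob
    plus  : Obj → W.Ob
    map   : ∀ x y → V.Hom (minus x) (minus y) → W.Hom (plus x) (plus y)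
    map-mono : ∀ x y {u v : V.Hom (minus x) (minus y)} →
               u V.≤ v → map x y u W.≤ map x y v
    map-⊗ : ∀ x y z (u : V.Hom (minus x) (minus y)) (v : V.Hom (minus y) (minus z)) →
            map x y u W.⊗ map y z v W.≤ map x z (u V.⊗ v)
    map-id : ∀ x → W.id W.≤ map x x V.id

HasRightAdjoint : (V W : Quantaloid) {a b : Quantaloid.Ob V} {c d : Quantaloid.Ob W} →
  (Quantaloid.Hom V a b → Quantaloid.Hom W c d) → Set
HasRightAdjoint V W {a} {b} {c} {d} g =
  Σ (Quantaloid.Hom W c d → Quantaloid.Hom V a b) λ r →
    ∀ u w → (Quantaloid._≤_ W (g u) w) ⇔ (Quantaloid._≤_ V u (r w))

module ChangeOfBase {V W : Quantaloid} (F : TwoSidedEnrichment V W) where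
  private
    module V = Quantaloid V
    module W = Quantaloid W
    module LV = QuantaloidLemmas V
  module F = TwoSidedEnrichment F
  open VCat

  cob : VCat V → VCat W
  cob A = record
    { Obj  = Σ (Obj A) λ a → Σ F.Obj λ x → ty A a ≡ F.minus x
    ; ty   = λ { (a , x , e) → F.plus x }
    ; hom  = λ { (a , x , e) (b , y , e') → F.map x y (LV.cast e e' (hom A a b)) }
    ; hom-id   = λ { (a , x , e) →
        W.≤-trans (F.map-id x)
          (F.map-mono x x
            (V.≤-trans (LV.≤-reflexive (sym (LV.cast-id e)))
                       (LV.cast-mono e e (hom-id A a)))) }
    ; hom-comp = λ { (a , x , e) (b , y , e') (c , z , e'') →
        W.≤-trans (F.map-⊗ x y z _ _)
          (F.map-mono x z
            (V.≤-trans (LV.≤-reflexive (LV.cast-⊗ e e' e'' (hom A a b) (hom A b c)))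
                       (LV.cast-mono e e'' (hom-comp A a b c)))) }
    }

  cobFun : {A B : VCat V} → VFunctor A B → VFunctor (cob A) (cob B)
  cobFun {A} {B} f = record
    { fun  = λ { (a , x , e) → (VFunctor.fun f a , x , trans (VFunctor.pres f a) e) }
    ; pres = λ _ → refl
    ; mono = λ { (a , x , e) (a' , x' , e') →
        F.map-mono x x'
          (V.≤-trans (LV.cast-mono e e' (VFunctor.mono f a a'))
                     (LV.≤-reflexive (LV.cast-cast (VFunctor.pres f a) (VFunctor.pres f a') e e' _))) }
    }

{-# OPTIONS --safe #-}
-- Each F_{x,y} is a left adjoint, so it preserves all joins.  The functional-bisimulation
-- equation and the simulation inequality are both statements about joins of hom-arrows, so
-- applying F_{x,y} termwise carries them over to F_@, since the objects of F_@A lying over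
-- x ∈ Obj(F) are just the a ∈ Obj(A) with a₊ = x₋.  A bisimulation R lifts to
-- (a , x) R̂ (b , y) ⟺ a R b ∧ x = y.  By UIP, transport along equalities of objects does not
-- depend on the equality proofs, which disposes of all the bookkeeping with casts.
module Submission where

open import Defs
open import Data.Product using (_×_; Σ; _,_; proj₁; proj₂; map₂)
open import Function using (flip)
open import Function.Bundles using (Equivalence)
open import Relation.Binary.PropositionalEquality using (_≡_; refl; sym; trans; cong)
open import Axiom.UniquenessOfIdentityProofs.WithK using (uip)

module QuantaloidProperties (Q : Quantaloid) where
  open Quantaloid Q
  open QuantaloidLemmas Q

  cast-irrelevant : ∀ {x x' y y'} (e e' : x ≡ x') (d d' : y ≡ y') (u : Hom x y) →
                    cast e d u ≡ cast e' d' u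
  cast-irrelevant e e' d d' u rewrite uip e e' | uip d d' = refl

  cast-cast-irrelevant : ∀ {x x' x'' y y' y''} (e₁ : x ≡ x') (d₁ : y ≡ y')
                         (e₂ : x' ≡ x'') (d₂ : y' ≡ y'') (e : x ≡ x'') (d : y ≡ y'')
                         (u : Hom x y) → cast e₂ d₂ (cast e₁ d₁ u) ≡ cast e d u
  cast-cast-irrelevant e₁ d₁ e₂ d₂ e d u =
    trans (cast-cast e₁ d₁ e₂ d₂ u) (cast-irrelevant _ e _ d u)

  cast-⋁ : ∀ {x x' y y'} (e : x ≡ x') (d : y ≡ y') (I : Set) (u : I → Hom x y) →
           cast e d (⋁ I u) ≡ ⋁ I (λ i → cast e d (u i))
  cast-⋁ refl refl I u = refl

  ⋁-dominated : ∀ {x y} {I J : Set} {u : I → Hom x y} {v : J → Hom x y} →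
                (∀ i → Σ J λ j → u i ≤ v j) → ⋁ I u ≤ ⋁ J v
  ⋁-dominated {v = v} dom =
    ⋁-least _ _ λ i → ≤-trans (proj₂ (dom i)) (⋁-ub v (proj₁ (dom i)))

-- No monotonicity hypothesis is needed: u i ≤ ⋁ u ≤ r (g (⋁ u)) already gives g (u i) ≤ g (⋁ u).
left-adjoint-preserves-⋁ : (V W : Quantaloid) {a b : Quantaloid.Ob V} {c d : Quantaloid.Ob W}
  {g : Quantaloid.Hom V a b → Quantaloid.Hom W c d} → HasRightAdjoint V W g →
  (I : Set) (u : I → Quantaloid.Hom V a b) →
  g (Quantaloid.⋁ V I u) ≡ Quantaloid.⋁ W I (λ i → g (u i))
left-adjoint-preserves-⋁ V W {g = g} (r , g⊣r) I u =
  W.≤-antisym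
    (Equivalence.from (g⊣r _ _)
      (V.⋁-least u _ λ i → Equivalence.to (g⊣r _ _) (W.⋁-ub (λ i → g (u i)) i)))
    (W.⋁-least _ _ λ i → Equivalence.from (g⊣r _ _)
      (V.≤-trans (V.⋁-ub u i) (Equivalence.to (g⊣r _ _) W.≤-refl)))
  where
  module V = Quantaloid V
  module W = Quantaloid W

module _ {V : Quantaloid} where
  open Quantaloid V
  open QuantaloidLemmas V
  open QuantaloidProperties V
  open VCat

  IsSimulation-resp : {A B : VCat V} {R S : Obj A → Obj B → Set} →
    (∀ {a b} → R a b → S a b) → (∀ {a b} → S a b → R a b) →
    IsSimulation A B R → IsSimulation A B S
  IsSimulation-resp {B = B} R⇒S S⇒R (typ , sim) =
    (λ s → typ (S⇒R s)) ,
    λ a b s a' → ≤-trans (sim a b (S⇒R s) a')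
      (⋁-dominated λ { (b' , r') → (b' , R⇒S r') ,
        ≤-reflexive (cast-irrelevant _ _ (sym (typ r')) _ (hom B b b')) })

module ChangeOfBaseProperties {V W : Quantaloid} (F : TwoSidedEnrichment V W)
  (radj : ∀ x y → HasRightAdjoint V W (TwoSidedEnrichment.map F x y)) where
  private
    module V = Quantaloid V
    module W = Quantaloid W
    module LV = QuantaloidLemmas V
    module LW = QuantaloidLemmas W
    module PV = QuantaloidProperties V
    module PW = QuantaloidProperties W
  open ChangeOfBase F
  open VCat
  open VFunctor

  map-cast-⋁ : ∀ x y {o o'} (e : o ≡ F.minus x) (e' : o' ≡ F.minus y) (I : Set)
               (u : I → V.Hom o o') →
               F.map x y (LV.cast e e' (V.⋁ I u)) ≡ W.⋁ I (λ i → F.map x y (LV.cast e e' (u i)))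
  map-cast-⋁ x y e e' I u =
    trans (cong (F.map x y) (PV.cast-⋁ e e' I u))
          (left-adjoint-preserves-⋁ V W (radj x y) I _)

  cast-map-cast : ∀ {x x' y y' o o'} → x ≡ x' → y ≡ y' →
    (c : F.plus x ≡ F.plus x') (d : F.plus y ≡ F.plus y')
    (e : o ≡ F.minus x) (e' : o' ≡ F.minus y) (ε : o ≡ F.minus x') (ε' : o' ≡ F.minus y')
    (h : V.Hom o o') →
    LW.cast c d (F.map x y (LV.cast e e' h)) ≡ F.map x' y' (LV.cast ε ε' h)
  cast-map-cast refl refl c d e e' ε ε' h rewrite uip c refl | uip d refl =
    cong (F.map _ _) (PV.cast-irrelevant e ε e' ε' h)

  cobObj-≡ : {B : VCat V} {b b' : Obj B} {y : F.Obj}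
    {e : ty B b ≡ F.minus y} {e' : ty B b' ≡ F.minus y} → b ≡ b' →
    _≡_ {A = Obj (cob B)} (b , y , e) (b' , y , e')
  cobObj-≡ {e = e} {e'} refl rewrite uip e e' = refl

  cobRel : (A B : VCat V) → (Obj A → Obj B → Set) → Obj (cob A) → Obj (cob B) → Set
  cobRel A B R (a , x , _) (b , y , _) = R a b × x ≡ y

  cob-preserves-simulation : {A B : VCat V} {R : Obj A → Obj B → Set} →
    IsSimulation A B R → IsSimulation (cob A) (cob B) (cobRel A B R)
  cob-preserves-simulation {B = B} (typ , sim) = (λ (_ , x≡y) → cong F.plus x≡y) ,
    λ { (a , x , e) (b , _ , e') (r , x≡y) (a' , x' , e'') →
      W.≤-trans (F.map-mono x x' (LV.cast-mono e e'' (sim a b r a')))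
        (W.≤-trans (LW.≤-reflexive (map-cast-⋁ x x' e e'' _ _))
          (PW.⋁-dominated λ { (b' , r') →
            let e₃ = trans (sym (typ r')) e''
                ε  = trans (sym (typ r)) e in
            ((b' , x' , e₃) , (r' , refl)) ,
            LW.≤-reflexive
              (trans (cong (F.map x x') (PV.cast-cast-irrelevant _ _ e e'' ε e₃ (hom B b b')))
                     (sym (cast-map-cast (sym x≡y) refl _ _ e' e₃ ε e₃ (hom B b b')))) })) }

  cobRel-total : {A B : VCat V} {R : Obj A → Obj B → Set} →
    (∀ {a b} → R a b → ty A a ≡ ty B b) →
    (∀ a → Σ (Obj B) λ b → R a b) → ∀ â → Σ (Obj (cob B)) λ b̂ → cobRel A B R â b̂
  cobRel-total typ total (a , x , e) =
    let (b , r) = total a in (b , x , trans (sym (typ r)) e) , (r , refl)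

  cob-preserves-bisimilarity : {A B : VCat V} → Bisimilar A B → Bisimilar (cob A) (cob B)
  cob-preserves-bisimilarity {A} {B} (R , (simR , simR⁻¹) , totalA , totalB) =
    cobRel A B R ,
    (cob-preserves-simulation {A} {B} {R} simR ,
     IsSimulation-resp {A = cob B} {cob A} (map₂ sym) (map₂ sym)
       (cob-preserves-simulation {B} {A} {flip R} simR⁻¹)) ,
    cobRel-total {A} {B} {R} (proj₁ simR) totalA ,
    λ b̂ → map₂ (map₂ sym) (cobRel-total {B} {A} {flip R} (proj₁ simR⁻¹) totalB b̂)

  cobFun-preserves-surjectivity : {A B : VCat V} (f : VFunctor A B) →
    SurjectiveOnObjects f → SurjectiveOnObjects (cobFun f)
  cobFun-preserves-surjectivity {B = B} f surj (b , y , e') =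
    let (a , fa≡b) = surj b in
    (a , y , trans (sym (pres f a)) (trans (cong (ty B) fa≡b) e')) , cobObj-≡ {B = B} fa≡b

  cobFun-preserves-functional-bisimulation : {A B : VCat V} (f : VFunctor A B) →
    IsFunctionalBisimulation f → IsFunctionalBisimulation (cobFun f)
  cobFun-preserves-functional-bisimulation {A} {B} f bis (a , x , e) (b , y , e') =
    trans (cong (λ h → F.map x y (LV.cast (trans (pres f a) e) e' h)) (bis a b))
      (trans (map-cast-⋁ x y _ e' _ _)
        (W.≤-antisym
          (PW.⋁-dominated λ { (a' , fa'≡b) →
            ((a' , y , ε a' fa'≡b) , cobObj-≡ {B = B} fa'≡b) ,
            LW.≤-reflexive
              (trans (join-term-≡ a' fa'≡b)
                     (sym (cast-map-cast refl refl _ _ e _ e (ε a' fa'≡b) (hom A a a')))) })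
          (PW.⋁-dominated λ { ((a' , _ , e'') , p) →
            (a' , cong proj₁ p) ,
            LW.≤-reflexive
              (trans (cast-map-cast refl (cong (λ â → proj₁ (proj₂ â)) p) _ _ e e'' e _ (hom A a a'))
                     (sym (join-term-≡ a' (cong proj₁ p)))) })))
    where
    ε : ∀ a' → fun f a' ≡ b → ty A a' ≡ F.minus y
    ε a' fa'≡b = trans (sym (pres f a')) (trans (cong (ty B) fa'≡b) e')

    join-term-≡ : ∀ a' (fa'≡b : fun f a' ≡ b) →
      F.map x y (LV.cast (trans (pres f a) e) e'
        (LV.cast (sym (pres f a)) (trans (sym (pres f a')) (cong (ty B) fa'≡b)) (hom A a a')))
      ≡ F.map x y (LV.cast e (ε a' fa'≡b) (hom A a a'))
    join-term-≡ a' fa'≡b = cong (F.map x y)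
      (PV.cast-cast-irrelevant (sym (pres f a)) (trans (sym (pres f a')) (cong (ty B) fa'≡b))
        (trans (pres f a) e) e' e (ε a' fa'≡b) (hom A a a'))

mainTheorem13 : (V W : Quantaloid) (F : TwoSidedEnrichment V W) →
    (∀ x y → HasRightAdjoint V W (TwoSidedEnrichment.map F x y)) →
    ((A B : VCat V) (f : VFunctor A B) →
       InOd f → InOd (ChangeOfBase.cobFun F f))
    × ((A B : VCat V) →
       Bisimilar A B → Bisimilar (ChangeOfBase.cob F A) (ChangeOfBase.cob F B))
mainTheorem13 V W F radj =
  (λ A B f (bis , surj) →
     cobFun-preserves-functional-bisimulation f bis , cobFun-preserves-surjectivity f surj) ,
  (λ A B → cob-preserves-bisimilarity {A} {B})
  where open ChangeOfBaseProperties F radj
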